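{- Let $M$ and $N$ be canonical terms of observation depth $\omega$ (infinitary productive Böhm trees), $x$ a variable and $\tau$ a simple type. Then $[N/x]^\tau M$, whenever it is defined, is a canonical term of observation depth $\omega$.
   Context: Constants $c$ form an infinite set disjoint from variables; binders are never constants and constants are unaffected by substitution. Terms are possibly infinite trees in head-spine form: $h\cdot(M_1;\dots;M_n)$ is a head $h$ (variable or constant) applied to finitely many arguments; $\operatorname{()}$ is the empty spine. Observation depth: for each $k$, canonical terms $M_{(k)}$, neutral terms $R_{(k)}$, continuing spines $T_{(k)}$ and suspended spines $S_{(k)}$ of depth $k$ are defined by: at depth $0$ every tree is admitted; at depth $k+1$ they are generated inductively (finite derivations) by $M_{(k+1)} ::= \lambda x.\, M_{(k+1)} \mid R_{(k+1)}$; $R_{(k+1)} ::= x\cdot T_{(k+1)} \mid c\cdot S_{(k+1)}$; $T_{(k+1)} ::= \operatorname{()} \mid M_{(k+1)}; T_{(k+1)}$; $S_{(k+1)} ::= \operatorname{()} \mid M_{(k)}; S_{(k+1)}$. A canonical term of depth $\omega$ is a tree that is a canonical term of depth $k$ for every $k$. A term of depth $k+1$ may be regarded as a term of depth $k$. Two trees are equal up to depth $k$ ($=_{(k)}$): everything is equal at depth $0$; at depth $k+1$ equality is structural, comparing arguments of constant heads up to depth $k$ and all other subterms up to depth $k+1$; equality at depth $\omega$ means equality up to every depth $k$. Simple types: $\tau ::= * \mid \tau_1\to\tau_2$ (finite). Hereditary substitution $[N/x]^\tau$ is a partial operation defined, at each depth $k$, by lexicographic induction on $\tau$, $k$, and the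 structure of the term substituted into (undefined when no clause applies; results at depth $k$ determined up to $=_{(k)}$, any result acceptable at depth $0$); the depth-$\omega$ result is the term agreeing with the depth-$k$ results for all $k$. Clauses at depth $k+1$ ($N$ of depth $k+1$): $[N/x]^\tau(\lambda y.\, M) = \lambda y.\, [N/x]^\tau M$ (bound variables renamed apart); $[N/x]^\tau(x\cdot T) = ([N/x]^\tau T)\rhd^\tau N$; $[N/x]^\tau(y\cdot T) = y\cdot([N/x]^\tau T)$ for a variable $y\ne x$; $[N/x]^\tau(c\cdot S) = c\cdot([N/x]^\tau S)$ with $N$ regarded at depth $k$ and the suspended-spine clause; $[N/x]^\tau\operatorname{()}=\operatorname{()}$, $[N/x]^\tau(M;T) = ([N/x]^\tau M);([N/x]^\tau T)$ for continuing spines; $\operatorname{()}\rhd^{*} R = R$; $(N_1;T)\rhd^{\tau_2\to\tau_1}\lambda y.\, M = T\rhd^{\tau_1}([N_1/y]^{\tau_2}M)$; for suspended spines ($N$ of depth $k$, $S$ of depth $k+1$): $[N/x]^\tau\operatorname{()}=\operatorname{()}$, $[N/x]^\tau(M;S) = ([N/x]^\tau M);([N/x]^\tau S)$ with the first substitution at depth $k$. -}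

module Defs where

open import Data.Nat using (ℕ; zero; suc)
open import Data.List using (List; []; _∷_; map; upTo)
open import Data.List.Relation.Binary.Pointwise using (Pointwise)
open import Data.List.Relation.Unary.Any using (Any)
open import Data.Product using (_×_; _,_)
open import Relation.Binary.PropositionalEquality using (_≡_; _≢_)
open import Relation.Nullary using (¬_)

-- Variables and constants: two disjoint copies of ℕ (constants are an
-- infinite set disjoint from variables).

Var : Set
Var = ℕ

Const : Set
Const = ℕ

data Head : Set where
  var : Var → Head
  con : Const → Head

-- A (possibly infinite) tree is given by its node labels at every
-- position (a position is a finite path of child indices).  A label
-- 'lamL x' has one child (index 0, the body); a label 'appL h n' has the
-- n children 0 … n-1 (the spine).  Labels at positions that are not
-- reachable this way are irrelevant: every notion below only inspects a
-- tree through 'node'.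

data Label : Set where
  lamL : Var → Label
  appL : Head → ℕ → Label

Tree : Set
Tree = List ℕ → Label

child : Tree → ℕ → Tree
child t i p = t (i ∷ p)

data Node : Set where
  lam : Var → Tree → Node
  app : Head → List Tree → Node

nodeOf : Tree → Label → Node
nodeOf t (lamL x)   = lam x (child t 0)
nodeOf t (appL h n) = app h (map (child t) (upTo n))

node : Tree → Node
node t = nodeOf t (t [])

-- Observation depth: canonical terms, neutral terms, continuing and
-- suspended spines of depth k.  Depth 0 admits everything; depth k+1 is
-- generated inductively (finite derivations).

data Can : ℕ → Tree → Set
data Neu : ℕ → Tree → Set
data CSp : ℕ → List Tree → Set
data SSp : ℕ → List Tree → Set

data Can where
  can-0   : ∀ {M} → Can 0 M
  can-lam : ∀ {k M x B} → node M ≡ lam x B → Can (suc k) B → Can (suc k) M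
  can-neu : ∀ {k M} → Neu (suc k) M → Can (suc k) M

data Neu where
  neu-0   : ∀ {R} → Neu 0 R
  neu-var : ∀ {k R x T} → node R ≡ app (var x) T → CSp (suc k) T → Neu (suc k) R
  neu-con : ∀ {k R c S} → node R ≡ app (con c) S → SSp (suc k) S → Neu (suc k) R

data CSp where
  csp-0    : ∀ {T} → CSp 0 T
  csp-nil  : ∀ {k} → CSp (suc k) []
  csp-cons : ∀ {k M T} → Can (suc k) M → CSp (suc k) T → CSp (suc k) (M ∷ T)

data SSp where
  ssp-0    : ∀ {S} → SSp 0 S
  ssp-nil  : ∀ {k} → SSp (suc k) []
  ssp-cons : ∀ {k M S} → Can k M → SSp (suc k) S → SSp (suc k) (M ∷ S)

CanΩ : Tree → Set
CanΩ M = ∀ k → Can k M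

data EqD : ℕ → Tree → Tree → Set where
  eq-0   : ∀ {M M'} → EqD 0 M M'
  eq-lam : ∀ {k M M' x A A'} → node M ≡ lam x A → node M' ≡ lam x A' →
           EqD (suc k) A A' → EqD (suc k) M M'
  eq-var : ∀ {k M M' x T T'} → node M ≡ app (var x) T → node M' ≡ app (var x) T' →
           Pointwise (EqD (suc k)) T T' → EqD (suc k) M M'
  eq-con : ∀ {k M M' c S S'} → node M ≡ app (con c) S → node M' ≡ app (con c) S' →
           Pointwise (EqD k) S S' → EqD (suc k) M M'

data VarRel : List (Var × Var) → Var → Var → Set where
  vr-empty : ∀ {a} → VarRel [] a a
  vr-here  : ∀ {Γ a b} → VarRel ((a , b) ∷ Γ) a b
  vr-there : ∀ {Γ a b a' b'} → a ≢ a' → b ≢ b' → VarRel Γ a b →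
             VarRel ((a' , b') ∷ Γ) a b

data AlphaEq : ℕ → List (Var × Var) → Tree → Tree → Set where
  α-0   : ∀ {Γ M M'} → AlphaEq 0 Γ M M'
  α-lam : ∀ {k Γ M M' a b A B} → node M ≡ lam a A → node M' ≡ lam b B →
          AlphaEq (suc k) ((a , b) ∷ Γ) A B → AlphaEq (suc k) Γ M M'
  α-var : ∀ {k Γ M M' a b T T'} → node M ≡ app (var a) T → node M' ≡ app (var b) T' →
          VarRel Γ a b → Pointwise (AlphaEq (suc k) Γ) T T' → AlphaEq (suc k) Γ M M'
  α-con : ∀ {k Γ M M' c S S'} → node M ≡ app (con c) S → node M' ≡ app (con c) S' →
          Pointwise (AlphaEq k Γ) S S' → AlphaEq (suc k) Γ M M'

data FreeIn : ℕ → Var → Tree → Set where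
  fr-head : ∀ {k z N T} → node N ≡ app (var z) T → FreeIn (suc k) z N
  fr-lam  : ∀ {k z N y B} → node N ≡ lam y B → y ≢ z → FreeIn (suc k) z B →
            FreeIn (suc k) z N
  fr-var  : ∀ {k z N w T} → node N ≡ app (var w) T → Any (FreeIn (suc k) z) T →
            FreeIn (suc k) z N
  fr-con  : ∀ {k z N c S} → node N ≡ app (con c) S → Any (FreeIn k z) S →
            FreeIn (suc k) z N

data Ty : Set where
  ⋆   : Ty
  _⇒_ : Ty → Ty → Ty

-- Hereditary substitution, as a relation:
--   Sub k τ N x M P   :  P is an acceptable depth-k result of [N/x]^τ M
--   Red k τ T N P     :  P is an acceptable depth-k result of T ▷^τ N
-- (undefined = no derivation; at depth 0 every result is acceptable).

data Sub : ℕ → Ty → Tree → Var → Tree → Tree → Set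
data Red : ℕ → Ty → List Tree → Tree → Tree → Set

data Sub where
  sub-0   : ∀ {τ N x M P} → Sub 0 τ N x M P
  sub-lam : ∀ {k τ N x M P y A z A' B} →
            node M ≡ lam y A → node P ≡ lam z B →
            z ≢ x → ¬ FreeIn (suc k) z N →
            AlphaEq (suc k) ((y , z) ∷ []) A A' →
            Sub (suc k) τ N x A' B → Sub (suc k) τ N x M P
  sub-hd  : ∀ {k τ N x M P T T'} →
            node M ≡ app (var x) T →
            Pointwise (Sub (suc k) τ N x) T T' →
            Red (suc k) τ T' N P → Sub (suc k) τ N x M P
  sub-var : ∀ {k τ N x M P y T T'} →
            node M ≡ app (var y) T → y ≢ x → node P ≡ app (var y) T' →
            Pointwise (Sub (suc k) τ N x) T T' → Sub (suc k) τ N x M P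
  sub-con : ∀ {k τ N x M P c S S'} →
            node M ≡ app (con c) S → node P ≡ app (con c) S' →
            Pointwise (Sub k τ N x) S S' → Sub (suc k) τ N x M P

data Red where
  red-nil  : ∀ {k R P h S} → node R ≡ app h S → EqD k P R → Red k ⋆ [] R P
  red-cons : ∀ {k τ₁ τ₂ N₁ T L P y B Q} →
             node L ≡ lam y B → Sub k τ₂ N₁ y B Q → Red k τ₁ T Q P →
             Red k (τ₂ ⇒ τ₁) (N₁ ∷ T) L P

SubΩ : Ty → Tree → Var → Tree → Tree → Set
SubΩ τ N x M P = ∀ k → Sub k τ N x M P

-- The result is proved one finite depth k at a time, by induction on the
-- derivation of the depth-k substitution: every clause rebuilds the result
-- from canonical pieces with the same constructor shape.  The one point of
-- friction is a constant head, where the suspended spine is substituted one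
-- depth lower, so N must be lowered to depth k as well; this is possible
-- because canonicity is downward closed in the depth.  Renaming bound
-- variables apart and the =_(k) slack in () ▷ R do not change the shape of
-- a tree, hence preserve canonicity.
{-# OPTIONS --safe #-}
module Submission where

open import Defs
open import Data.Nat using (zero; suc)
open import Data.List.Relation.Binary.Pointwise using (Pointwise; []; _∷_)
open import Relation.Binary.PropositionalEquality using (_≡_; refl; sym; trans)

can-lam⁻¹ : ∀ {k M y A} → Can k M → node M ≡ lam y A → Can k A
can-lam⁻¹ can-0 _ = can-0
can-lam⁻¹ (can-lam e c) e' with trans (sym e) e'
... | refl = c
can-lam⁻¹ (can-neu (neu-var e _)) e' with trans (sym e) e'
... | ()
can-lam⁻¹ (can-neu (neu-con e _)) e' with trans (sym e) e'
... | ()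

can-var⁻¹ : ∀ {k M x T} → Can k M → node M ≡ app (var x) T → CSp k T
can-var⁻¹ can-0 _ = csp-0
can-var⁻¹ (can-lam e _) e' with trans (sym e) e'
... | ()
can-var⁻¹ (can-neu (neu-var e c)) e' with trans (sym e) e'
... | refl = c
can-var⁻¹ (can-neu (neu-con e _)) e' with trans (sym e) e'
... | ()

can-con⁻¹ : ∀ {k M c S} → Can k M → node M ≡ app (con c) S → SSp k S
can-con⁻¹ can-0 _ = ssp-0
can-con⁻¹ (can-lam e _) e' with trans (sym e) e'
... | ()
can-con⁻¹ (can-neu (neu-var e _)) e' with trans (sym e) e'
... | ()
can-con⁻¹ (can-neu (neu-con e c)) e' with trans (sym e) e'
... | refl = c

can-lower : ∀ {k M} → Can (suc k) M → Can k M
neu-lower : ∀ {k R} → Neu (suc k) R → Neu k R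
csp-lower : ∀ {k T} → CSp (suc k) T → CSp k T
ssp-lower : ∀ {k S} → SSp (suc k) S → SSp k S
can-lower {zero}  _             = can-0
can-lower {suc k} (can-lam e c) = can-lam e (can-lower c)
can-lower {suc k} (can-neu n)   = can-neu (neu-lower n)
neu-lower {zero}  _             = neu-0
neu-lower {suc k} (neu-var e c) = neu-var e (csp-lower c)
neu-lower {suc k} (neu-con e c) = neu-con e (ssp-lower c)
csp-lower {zero}  _                = csp-0
csp-lower {suc k} csp-nil          = csp-nil
csp-lower {suc k} (csp-cons c cs)  = csp-cons (can-lower c) (csp-lower cs)
ssp-lower {zero}  _                = ssp-0
ssp-lower {suc k} ssp-nil          = ssp-nil
ssp-lower {suc k} (ssp-cons c cs)  = ssp-cons (can-lower c) (ssp-lower cs)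

can-resp-EqD : ∀ {k P R} → EqD k P R → Can k R → Can k P
csp-resp-EqD : ∀ {k T T'} → Pointwise (EqD (suc k)) T T' → CSp (suc k) T' → CSp (suc k) T
ssp-resp-EqD : ∀ {k S S'} → Pointwise (EqD k) S S' → SSp (suc k) S' → SSp (suc k) S
can-resp-EqD eq-0               _ = can-0
can-resp-EqD (eq-lam eP eR q)   c = can-lam eP (can-resp-EqD q (can-lam⁻¹ c eR))
can-resp-EqD (eq-var eP eR qs)  c = can-neu (neu-var eP (csp-resp-EqD qs (can-var⁻¹ c eR)))
can-resp-EqD (eq-con eP eR qs)  c = can-neu (neu-con eP (ssp-resp-EqD qs (can-con⁻¹ c eR)))
csp-resp-EqD []       csp-nil         = csp-nil
csp-resp-EqD (q ∷ qs) (csp-cons c cs) = csp-cons (can-resp-EqD q c) (csp-resp-EqD qs cs)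
ssp-resp-EqD []       ssp-nil         = ssp-nil
ssp-resp-EqD (q ∷ qs) (ssp-cons c cs) = ssp-cons (can-resp-EqD q c) (ssp-resp-EqD qs cs)

can-resp-AlphaEq : ∀ {k Γ A A'} → AlphaEq k Γ A A' → Can k A → Can k A'
csp-resp-AlphaEq : ∀ {k Γ T T'} → Pointwise (AlphaEq (suc k) Γ) T T' → CSp (suc k) T → CSp (suc k) T'
ssp-resp-AlphaEq : ∀ {k Γ S S'} → Pointwise (AlphaEq k Γ) S S' → SSp (suc k) S → SSp (suc k) S'
can-resp-AlphaEq α-0                 _ = can-0
can-resp-AlphaEq (α-lam e e' q)      c = can-lam e' (can-resp-AlphaEq q (can-lam⁻¹ c e))
can-resp-AlphaEq (α-var e e' _ qs)   c = can-neu (neu-var e' (csp-resp-AlphaEq qs (can-var⁻¹ c e)))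
can-resp-AlphaEq (α-con e e' qs)     c = can-neu (neu-con e' (ssp-resp-AlphaEq qs (can-con⁻¹ c e)))
csp-resp-AlphaEq []       csp-nil         = csp-nil
csp-resp-AlphaEq (q ∷ qs) (csp-cons c cs) = csp-cons (can-resp-AlphaEq q c) (csp-resp-AlphaEq qs cs)
ssp-resp-AlphaEq []       ssp-nil         = ssp-nil
ssp-resp-AlphaEq (q ∷ qs) (ssp-cons c cs) = ssp-cons (can-resp-AlphaEq q c) (ssp-resp-AlphaEq qs cs)

sub-preserves-can : ∀ {k τ N x M P} → Sub k τ N x M P → Can k M → Can k N → Can k P
red-preserves-can : ∀ {k τ T L P} → Red k τ T L P → CSp k T → Can k L → Can k P
sub-preserves-csp : ∀ {k τ N x T T'} → Pointwise (Sub (suc k) τ N x) T T' →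
                    CSp (suc k) T → Can (suc k) N → CSp (suc k) T'
sub-preserves-ssp : ∀ {k τ N x S S'} → Pointwise (Sub k τ N x) S S' →
                    SSp (suc k) S → Can k N → SSp (suc k) S'
sub-preserves-can sub-0 _ _ = can-0
sub-preserves-can (sub-lam eM eP _ _ renamed s) cM cN =
  can-lam eP (sub-preserves-can s (can-resp-AlphaEq renamed (can-lam⁻¹ cM eM)) cN)
sub-preserves-can (sub-hd eM ss r) cM cN =
  red-preserves-can r (sub-preserves-csp ss (can-var⁻¹ cM eM) cN) cN
sub-preserves-can (sub-var eM _ eP ss) cM cN =
  can-neu (neu-var eP (sub-preserves-csp ss (can-var⁻¹ cM eM) cN))
sub-preserves-can (sub-con eM eP ss) cM cN =
  can-neu (neu-con eP (sub-preserves-ssp ss (can-con⁻¹ cM eM) (can-lower cN)))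
red-preserves-can {zero}  _                  _               _  = can-0
red-preserves-can {suc k} (red-nil _ q)      _               cL = can-resp-EqD q cL
red-preserves-can {suc k} (red-cons eL s r)  (csp-cons c cs) cL =
  red-preserves-can r cs (sub-preserves-can s (can-lam⁻¹ cL eL) c)
sub-preserves-csp []       csp-nil         _  = csp-nil
sub-preserves-csp (s ∷ ss) (csp-cons c cs) cN =
  csp-cons (sub-preserves-can s c cN) (sub-preserves-csp ss cs cN)
sub-preserves-ssp []       ssp-nil         _  = ssp-nil
sub-preserves-ssp (s ∷ ss) (ssp-cons c cs) cN =
  ssp-cons (sub-preserves-can s c cN) (sub-preserves-ssp ss cs cN)

mainTheorem3 : (τ : Ty) (x : Var) (M N P : Tree) →
    CanΩ M → CanΩ N → SubΩ τ N x M P → CanΩ P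
mainTheorem3 τ x M N P cM cN s k = sub-preserves-can (s k) (cM k) (cN k)
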